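{- Let $\mathcal{P}$ be a preference profile (ties and incomplete lists allowed) with acceptability graph $(V,E)$, let $\gamma\in\mathbb{N}$, and let $E_1=\{\{x,y\}\in E:\mathrm{rank}_x(y)+\mathrm{rank}_y(x)\le\gamma\}$. If two edges of $E_1$ block each other, then both of them are costly edges.
   Context: Agents $V$; agent $i$ has acceptable set $V_i\subseteq V\setminus\{i\}$ with a transitive complete relation $\succeq_i$ on $V_i$ ($\succ_i$ its strict part). Acceptability graph: edge $\{x,y\}$ iff $x\in V_y$ and $y\in V_x$. $\mathrm{rank}_j(i)=|\{x:x\succ_j i\}|$. The cost of an edge $\{x,y\}$ is $\mathrm{rank}_x(y)+\mathrm{rank}_y(x)$; an edge of $E_1$ is a zero edge if its cost is $0$ and a costly edge if its cost is between $1$ and $\gamma$. Two disjoint edges $e=\{u,v\}$ and $e'=\{u',v'\}$ block each other if, for some choice of endpoints $u\in e$, $u'\in e'$ (with $v,v'$ the other endpoints), $u'\succ_u v$ and $u\succ_{u'}v'$. -}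

module Defs where

open import Level using (0ℓ)
open import Data.Nat using (ℕ; _+_; _≤_)
open import Data.Fin using (Fin)
open import Data.List using (length; filter; allFin)
open import Data.Product using (_×_; Σ; ∃; _,_)
open import Data.Sum using (_⊎_)
open import Relation.Nullary using (¬_; Dec; ¬?; _×-dec_)
open import Relation.Binary.PropositionalEquality using (_≡_; _≢_)

-- A preference profile over the agent set V = Fin n (ties and incomplete lists allowed).
-- acc i x  : x ∈ V_i   (x is acceptable to i)
-- pref i x y : x ≽_i y  (a weak order on V_i)
record Profile (n : ℕ) : Set₁ where
  field
    acc      : Fin n → Fin n → Set
    pref     : Fin n → Fin n → Fin n → Set
    acc-irr  : ∀ i → ¬ acc i i
    pref-dom : ∀ i x y → pref i x y → acc i x × acc i y
    pref-refl  : ∀ i x → acc i x → pref i x x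
    pref-trans : ∀ i x y z → pref i x y → pref i y z → pref i x z
    pref-total : ∀ i x y → acc i x → acc i y → pref i x y ⊎ pref i y x
    pref-dec   : ∀ i x y → Dec (pref i x y)

module _ {n : ℕ} (P : Profile n) where
  open Profile P

  Strict : Fin n → Fin n → Fin n → Set
  Strict i x y = pref i x y × ¬ pref i y x

  strict? : ∀ i y x → Dec (Strict i x y)
  strict? i y x = pref-dec i x y ×-dec ¬? (pref-dec i y x)

  rank : Fin n → Fin n → ℕ
  rank j i = length (filter (strict? j i) (allFin n))

  IsEdge : Fin n → Fin n → Set
  IsEdge x y = acc y x × acc x y

  cost : Fin n → Fin n → ℕ
  cost x y = rank x y + rank y x

  InE1 : ℕ → Fin n → Fin n → Set
  InE1 γ x y = IsEdge x y × cost x y ≤ γ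

  Costly : ℕ → Fin n → Fin n → Set
  Costly γ x y = InE1 γ x y × 1 ≤ cost x y

  Disjoint : Fin n → Fin n → Fin n → Fin n → Set
  Disjoint a b c d = a ≢ c × a ≢ d × b ≢ c × b ≢ d

  Orient : Fin n → Fin n → Fin n → Fin n → Set
  Orient a b u v = (u ≡ a × v ≡ b) ⊎ (u ≡ b × v ≡ a)

  BlockEachOther : Fin n → Fin n → Fin n → Fin n → Set
  BlockEachOther a b c d =
    Disjoint a b c d ×
    Σ (Fin n) λ u → Σ (Fin n) λ v → Σ (Fin n) λ u' → Σ (Fin n) λ v' →
      Orient a b u v × Orient c d u' v' × Strict u u' v × Strict u' u v'

-- A blocking pair of edges {u,v}, {u',v'} has u' ≻_u v, so u' is a witness that
-- rank_u(v) ≥ 1; symmetrically rank_{u'}(v') ≥ 1. Hence both edges have positive cost,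
-- and being in E₁ they are costly.
module Submission where

open import Defs
open import Data.Nat using (ℕ; _≤_; _<_)
open import Data.Nat.Properties using (≤-trans; m≤m+n; m≤n+m)
open import Data.Fin using (Fin)
open import Data.Product using (_×_; _,_)
open import Data.Sum using (inj₁; inj₂)
open import Data.List.Membership.Propositional.Properties using (∈-filter⁺; ∈-allFin; ∈-length)
open import Relation.Binary.PropositionalEquality using (refl)

module _ {n : ℕ} (P : Profile n) where

  rank-pos : ∀ i x y → Strict P i x y → 0 < rank P i y
  rank-pos i x y x≻y = ∈-length (∈-filter⁺ (strict? P i y) (∈-allFin x) x≻y)

  cost-pos : ∀ a b u v w → Orient P a b u v → Strict P u w v → 0 < cost P a b
  cost-pos a b .a .b w (inj₁ (refl , refl)) w≻b = ≤-trans (rank-pos a w b w≻b) (m≤m+n _ _)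
  cost-pos a b .b .a w (inj₂ (refl , refl)) w≻a = ≤-trans (rank-pos b w a w≻a) (m≤n+m _ _)

lemma10 : {n : ℕ} (P : Profile n) (γ : ℕ) (a b c d : Fin n) →
          InE1 P γ a b → InE1 P γ c d → BlockEachOther P a b c d →
          Costly P γ a b × Costly P γ c d
lemma10 P γ a b c d ab∈E₁ cd∈E₁ (_ , u , v , u' , v' , uv , u'v' , u'≻v , u≻v') =
  (ab∈E₁ , cost-pos P a b u v u' uv u'≻v) , (cd∈E₁ , cost-pos P c d u' v' u u'v' u≻v')
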